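{- Let $M=(E,I)$ be a matroid representable over $\mathbb{F}_2$ with minimum circuit length $\ell$. Let $C$ be a circuit of $M$ of length $k\le 1.01\ell$ and let $C'\neq C$ be a circuit of $M$ of length $k'$. Then $|C'\setminus C|\ge k'/4$.
   Context: $M$ is representable over $\mathbb{F}_2$ if there are vectors $v_e$ over $\mathbb{F}_2$, $e\in E$, such that $S\subseteq E$ is independent iff $\{v_e:e\in S\}$ is linearly independent. A circuit is a minimal dependent set; its length is its cardinality; the minimum circuit length is the smallest length of a circuit. -}

module Defs where

open import Data.Nat using (ℕ; zero; suc)
open import Data.Bool using (Bool; true; false; _xor_; _∧_)
open import Data.Fin using (Fin)
import Data.Fin as F
open import Data.Fin.Subset using (Subset; _∈_; _⊂_)
open import Data.Product using (_×_; Σ)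
open import Relation.Binary.PropositionalEquality using (_≡_)
open import Relation.Nullary using (¬_)
open import Function.Bundles using (_⇔_)

-- Vectors in F₂^d, with F₂ = Bool (false = 0, true = 1, xor = +, ∧ = ·).
F2Vec : ℕ → Set
F2Vec d = Fin d → Bool

lincomb : ∀ {n d} → (Fin n → Bool) → (Fin n → F2Vec d) → F2Vec d
lincomb {zero}  c v i = false
lincomb {suc n} c v i = (c F.zero ∧ v F.zero i) xor lincomb (λ e → c (F.suc e)) (λ e → v (F.suc e)) i

LinIndep : ∀ {n d} → (Fin n → F2Vec d) → Subset n → Set
LinIndep {n} v S =
  (c : Fin n → Bool) → (∀ e → c e ≡ true → e ∈ S) →
  (∀ i → lincomb c v i ≡ false) → ∀ e → c e ≡ false

-- A set system on the finite ground set E = Fin n, given by its independence predicate.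
-- M is representable over F₂ (the vectors v e live in some F₂^d).
BinaryRepresentable : ∀ {n} → (Subset n → Set) → Set
BinaryRepresentable {n} Indep =
  Σ ℕ λ d → Σ (Fin n → F2Vec d) λ v → ∀ S → Indep S ⇔ LinIndep v S

IsCircuit : ∀ {n} → (Subset n → Set) → Subset n → Set
IsCircuit {n} Indep C = ¬ Indep C × (∀ S → S ⊂ C → Indep S)

{-# OPTIONS --safe #-}
-- Write a = |C' ─ C|, b = |C ─ C'| and i = |C' ∩ C|. Over F₂ the vectors of every circuit
-- sum to zero, hence so do those of the nonempty set C' Δ C, which therefore contains a
-- circuit: ℓ ≤ a + b. Together with ℓ ≤ |C'| = a + i and b + i = |C| ≤ 1.01 ℓ this gives
-- 0.99 ℓ ≤ 2a, and then i ≤ 1.01 ℓ ≤ 3a, i.e. |C'| = a + i ≤ 4a.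
module Submission where

open import Defs
open import Data.Nat as ℕ using (ℕ; _≤_; _*_; _+_)
open import Data.Nat.Properties
  using (≤-trans; +-mono-≤; +-monoʳ-≤; *-monoʳ-≤; +-cancelʳ-≤; *-cancelˡ-≤; m≤m+n; m≤n+m; +-suc; module ≤-Reasoning)
open import Data.Nat.Tactic.RingSolver using (solve)
open import Data.Bool using (Bool; true; false; _xor_; _∧_)
open import Data.Bool.Properties using (_≟_; ∧-distribʳ-xor; xor-∧-commutativeRing)
open import Algebra.Bundles using (CommutativeRing)
open import Algebra.Properties.CommutativeSemigroup
  (CommutativeRing.+-commutativeSemigroup xor-∧-commutativeRing) using (interchange)
open import Data.Fin using (Fin; zero; suc)
open import Data.Fin.Properties using (all?)
open import Data.Fin.Subset using (Subset; ∣_∣; _─_; _∩_; _∈_; _⊆_; _⊂_; Nonempty)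
open import Data.Fin.Subset.Properties
  using (_∈?_; _⊆?_; _⊂?_; nonempty?; anySubset?; ⊆-refl; ⊆-trans; ⊆-antisym; ⊆-⊂-trans; ∩-comm;
         p⊂q⇒p⊆q; p⊆q⇒∣p∣≤∣q∣)
open import Data.Fin.Subset.Induction using (Acc; acc; ⊂-wellFounded)
open import Data.Vec using (lookup; tabulate; zipWith)
open import Data.Vec.Properties using ([]=⇒lookup; lookup⇒[]=; lookup∘tabulate; lookup-zipWith)
open import Data.List using ([]; _∷_)
open import Data.Product using (_×_; Σ; ∃; _,_; proj₁; proj₂)
open import Data.Empty using (⊥-elim)
open import Function using (_∘_)
open import Function.Bundles using (_⇔_; Equivalence)
open import Relation.Nullary using (¬_; yes; no; contradiction)
open import Relation.Nullary.Decidable using (_×-dec_; decidable-stable)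
open import Relation.Unary using (Decidable)
open import Relation.Binary.PropositionalEquality
  using (_≡_; _≢_; _≗_; refl; sym; trans; cong; cong₂; subst; module ≡-Reasoning)

lincomb-cong : ∀ {n d} {c c' : Fin n → Bool} (v : Fin n → F2Vec d) →
               c ≗ c' → lincomb c v ≗ lincomb c' v
lincomb-cong {ℕ.zero}  v c≗c' i = refl
lincomb-cong {ℕ.suc n} v c≗c' i =
  cong₂ (λ x y → (x ∧ v zero i) xor y) (c≗c' zero) (lincomb-cong (v ∘ suc) (c≗c' ∘ suc) i)

lincomb-xor : ∀ {n d} (c c' : Fin n → Bool) (v : Fin n → F2Vec d) i →
              lincomb (λ e → c e xor c' e) v i ≡ lincomb c v i xor lincomb c' v i
lincomb-xor {ℕ.zero}  c c' v i = refl
lincomb-xor {ℕ.suc n} c c' v i =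
  trans (cong₂ _xor_ (∧-distribʳ-xor (v zero i) (c zero) (c' zero))
                     (lincomb-xor (c ∘ suc) (c' ∘ suc) (v ∘ suc) i))
        (interchange (c zero ∧ v zero i) (c' zero ∧ v zero i)
                     (lincomb (c ∘ suc) (v ∘ suc) i) (lincomb (c' ∘ suc) (v ∘ suc) i))

∈-tabulate⁺ : ∀ {n} {c : Fin n → Bool} {x} → c x ≡ true → x ∈ tabulate c
∈-tabulate⁺ {c = c} {x} cx = lookup⇒[]= x (tabulate c) (trans (lookup∘tabulate c x) cx)

∈-tabulate⁻ : ∀ {n} {c : Fin n → Bool} {x} → x ∈ tabulate c → c x ≡ true
∈-tabulate⁻ {c = c} {x} x∈ = trans (sym (lookup∘tabulate c x)) ([]=⇒lookup x∈)

infixl 5 _Δ_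

_Δ_ : ∀ {n} → Subset n → Subset n → Subset n
p Δ q = zipWith _xor_ p q

-- The Vec constructors are opened only here, so that elsewhere [] and _∷_ unambiguously
-- build the List of variables passed to the ring solver.
module _ where
  open import Data.Vec using ([]; _∷_; here; there)

  Δ-nonempty : ∀ {n} {p q : Subset n} → p ≢ q → Nonempty (p Δ q)
  Δ-nonempty {p = []}        {[]}        p≢q = ⊥-elim (p≢q refl)
  Δ-nonempty {p = true ∷ p}  {false ∷ q} _   = zero , here
  Δ-nonempty {p = false ∷ p} {true ∷ q}  _   = zero , here
  Δ-nonempty {p = true ∷ p}  {true ∷ q}  p≢q with x , x∈ ← Δ-nonempty (p≢q ∘ cong (true ∷_)) =
    suc x , there x∈
  Δ-nonempty {p = false ∷ p} {false ∷ q} p≢q with x , x∈ ← Δ-nonempty (p≢q ∘ cong (false ∷_)) =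
    suc x , there x∈

  ∣p∣≡∣p─q∣+∣p∩q∣ : ∀ {n} (p q : Subset n) → ∣ p ∣ ≡ ∣ p ─ q ∣ + ∣ p ∩ q ∣
  ∣p∣≡∣p─q∣+∣p∩q∣ []          []          = refl
  ∣p∣≡∣p─q∣+∣p∩q∣ (true ∷ p)  (true ∷ q)  = trans (cong ℕ.suc (∣p∣≡∣p─q∣+∣p∩q∣ p q)) (sym (+-suc _ _))
  ∣p∣≡∣p─q∣+∣p∩q∣ (true ∷ p)  (false ∷ q) = cong ℕ.suc (∣p∣≡∣p─q∣+∣p∩q∣ p q)
  ∣p∣≡∣p─q∣+∣p∩q∣ (false ∷ p) (true ∷ q)  = ∣p∣≡∣p─q∣+∣p∩q∣ p q
  ∣p∣≡∣p─q∣+∣p∩q∣ (false ∷ p) (false ∷ q) = ∣p∣≡∣p─q∣+∣p∩q∣ p q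

  ∣pΔq∣≡∣p─q∣+∣q─p∣ : ∀ {n} (p q : Subset n) → ∣ p Δ q ∣ ≡ ∣ p ─ q ∣ + ∣ q ─ p ∣
  ∣pΔq∣≡∣p─q∣+∣q─p∣ []          []          = refl
  ∣pΔq∣≡∣p─q∣+∣q─p∣ (true ∷ p)  (true ∷ q)  = ∣pΔq∣≡∣p─q∣+∣q─p∣ p q
  ∣pΔq∣≡∣p─q∣+∣q─p∣ (true ∷ p)  (false ∷ q) = cong ℕ.suc (∣pΔq∣≡∣p─q∣+∣q─p∣ p q)
  ∣pΔq∣≡∣p─q∣+∣q─p∣ (false ∷ p) (true ∷ q)  = trans (cong ℕ.suc (∣pΔq∣≡∣p─q∣+∣q─p∣ p q)) (sym (+-suc _ _))
  ∣pΔq∣≡∣p─q∣+∣q─p∣ (false ∷ p) (false ∷ q) = ∣pΔq∣≡∣p─q∣+∣q─p∣ p q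

module Cycles {n d : ℕ} (v : Fin n → F2Vec d) where

  ZeroSum : Subset n → Set
  ZeroSum T = ∀ i → lincomb (lookup T) v i ≡ false

  Cycle : Subset n → Set
  Cycle T = Nonempty T × ZeroSum T

  cycle? : Decidable Cycle
  cycle? T = nonempty? T ×-dec all? (λ i → lincomb (lookup T) v i ≟ false)

  zeroSum-Δ : ∀ {S T} → ZeroSum S → ZeroSum T → ZeroSum (S Δ T)
  zeroSum-Δ {S} {T} zS zT i = begin
    lincomb (lookup (S Δ T)) v i                       ≡⟨ lincomb-cong v (λ e → lookup-zipWith _xor_ e S T) i ⟩
    lincomb (λ e → lookup S e xor lookup T e) v i      ≡⟨ lincomb-xor (lookup S) (lookup T) v i ⟩
    lincomb (lookup S) v i xor lincomb (lookup T) v i  ≡⟨ cong₂ _xor_ (zS i) (zT i) ⟩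
    false                                              ∎
    where open ≡-Reasoning

  cycle⇒¬linIndep : ∀ {S T} → T ⊆ S → Cycle T → ¬ LinIndep v S
  cycle⇒¬linIndep {S} {T} T⊆S ((x , x∈T) , zT) li =
    contradiction (trans (sym ([]=⇒lookup x∈T)) (li (lookup T) T-supported zT x)) λ ()
    where
    T-supported : ∀ e → lookup T e ≡ true → e ∈ S
    T-supported e Te = T⊆S (lookup⇒[]= e T Te)

  noCycle⇒linIndep : ∀ {S} → ¬ (∃ λ T → T ⊆ S × Cycle T) → LinIndep v S
  noCycle⇒linIndep noCycle c c⊆S zc e with c e in ce
  ... | false = refl
  ... | true  = ⊥-elim (noCycle (tabulate c , c⊆S _ ∘ ∈-tabulate⁻ , (e , ∈-tabulate⁺ ce) , zero-sum))
    where
    zero-sum : ZeroSum (tabulate c)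
    zero-sum i = trans (lincomb-cong v (lookup∘tabulate c) i) (zc i)

module Circuits {n d : ℕ} {v : Fin n → F2Vec d} {Indep : Subset n → Set}
                (rep : ∀ S → Indep S ⇔ LinIndep v S) where

  open Cycles v
  open Equivalence

  dependent⇒⊇cycle : ∀ {S} → ¬ Indep S → ∃ λ T → T ⊆ S × Cycle T
  dependent⇒⊇cycle {S} dep =
    decidable-stable (anySubset? (λ T → T ⊆? S ×-dec cycle? T)) (dep ∘ from (rep S) ∘ noCycle⇒linIndep)

  cycle⊆circuit⇒≡ : ∀ {C T} → IsCircuit Indep C → T ⊆ C → Cycle T → T ≡ C
  cycle⊆circuit⇒≡ {C} {T} (_ , ⊂C⇒indep) T⊆C cyc = ⊆-antisym T⊆C C⊆T
    where
    C⊆T : C ⊆ T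
    C⊆T {x} x∈C with x ∈? T
    ... | yes x∈T = x∈T
    ... | no  x∉T = ⊥-elim (cycle⇒¬linIndep ⊆-refl cyc (to (rep T) (⊂C⇒indep T (T⊆C , x , x∈C , x∉T))))

  circuit⇒cycle : ∀ {C} → IsCircuit Indep C → Cycle C
  circuit⇒cycle circ with T , T⊆C , cyc ← dependent⇒⊇cycle (proj₁ circ) =
    subst Cycle (cycle⊆circuit⇒≡ circ T⊆C cyc) cyc

  cycle⇒⊇circuit : ∀ {T} → Cycle T → ∃ λ D → D ⊆ T × IsCircuit Indep D
  cycle⇒⊇circuit {T} = go (⊂-wellFounded T)
    where
    go : ∀ {T} → Acc _⊂_ T → Cycle T → ∃ λ D → D ⊆ T × IsCircuit Indep D
    go {T} (acc rec) cyc with anySubset? (λ T' → T' ⊂? T ×-dec cycle? T')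
    ... | yes (T' , T'⊂T , cyc') with D , D⊆T' , circ ← go (rec T'⊂T) cyc' =
      D , ⊆-trans D⊆T' (p⊂q⇒p⊆q T'⊂T) , circ
    ... | no noSmaller = T , ⊆-refl , dependent , ⊂T⇒indep
      where
      dependent : ¬ Indep T
      dependent = cycle⇒¬linIndep ⊆-refl cyc ∘ to (rep T)
      ⊂T⇒indep : ∀ S → S ⊂ T → Indep S
      ⊂T⇒indep S S⊂T = from (rep S) (noCycle⇒linIndep λ (T' , T'⊆S , cyc') →
                                        noSmaller (T' , ⊆-⊂-trans T'⊆S S⊂T , cyc'))

  circuit-bound⇒cycle-bound : ∀ {ℓ T} → (∀ D → IsCircuit Indep D → ℓ ≤ ∣ D ∣) → Cycle T → ℓ ≤ ∣ T ∣
  circuit-bound⇒cycle-bound ℓ≤circuit cyc with D , D⊆T , circ ← cycle⇒⊇circuit cyc =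
    ≤-trans (ℓ≤circuit D circ) (p⊆q⇒∣p∣≤∣q∣ D⊆T)

  Δ-cycle : ∀ {C C'} → IsCircuit Indep C → IsCircuit Indep C' → C ≢ C' → Cycle (C Δ C')
  Δ-cycle {C} {C'} circ circ' C≢C' =
    Δ-nonempty C≢C' , zeroSum-Δ {C} {C'} (proj₂ (circuit⇒cycle circ)) (proj₂ (circuit⇒cycle circ'))

twice-difference-bound : ∀ {ℓ a b i} → ℓ ≤ a + i → ℓ ≤ a + b → 100 * (b + i) ≤ 101 * ℓ →
                         99 * ℓ ≤ 200 * a
twice-difference-bound {ℓ} {a} {b} {i} ℓ≤a+i ℓ≤a+b 100[b+i]≤101ℓ = +-cancelʳ-≤ (101 * ℓ) _ _ (begin
  99 * ℓ + 101 * ℓ               ≡⟨ solve (ℓ ∷ []) ⟩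
  100 * ℓ + 100 * ℓ              ≤⟨ +-mono-≤ (*-monoʳ-≤ 100 ℓ≤a+i) (*-monoʳ-≤ 100 ℓ≤a+b) ⟩
  100 * (a + i) + 100 * (a + b)  ≡⟨ solve (a ∷ b ∷ i ∷ []) ⟩
  200 * a + 100 * (b + i)        ≤⟨ +-monoʳ-≤ (200 * a) 100[b+i]≤101ℓ ⟩
  200 * a + 101 * ℓ              ∎)
  where open ≤-Reasoning

overlap-bound : ∀ {ℓ a b i} → ℓ ≤ a + i → ℓ ≤ a + b → 100 * (b + i) ≤ 101 * ℓ → i ≤ 3 * a
overlap-bound {ℓ} {a} {b} {i} ℓ≤a+i ℓ≤a+b 100[b+i]≤101ℓ = *-cancelˡ-≤ 9900 (begin
  9900 * i                     ≡⟨ solve (i ∷ []) ⟩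
  99 * (100 * i)               ≤⟨ *-monoʳ-≤ 99 (≤-trans (*-monoʳ-≤ 100 (m≤n+m i b)) 100[b+i]≤101ℓ) ⟩
  99 * (101 * ℓ)               ≡⟨ solve (ℓ ∷ []) ⟩
  101 * (99 * ℓ)               ≤⟨ *-monoʳ-≤ 101 99ℓ≤200a ⟩
  101 * (200 * a)              ≤⟨ m≤m+n _ (9500 * a) ⟩
  101 * (200 * a) + 9500 * a   ≡⟨ solve (a ∷ []) ⟩
  9900 * (3 * a)               ∎)
  where
  open ≤-Reasoning
  99ℓ≤200a : 99 * ℓ ≤ 200 * a
  99ℓ≤200a = twice-difference-bound {ℓ} {a} {b} {i} ℓ≤a+i ℓ≤a+b 100[b+i]≤101ℓ

mainTheorem13 : (n : ℕ) (Indep : Subset n → Set) → BinaryRepresentable Indep →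
    (ℓ : ℕ) → (Σ (Subset n) λ C₀ → IsCircuit Indep C₀ × ∣ C₀ ∣ ≡ ℓ) →
    (∀ D → IsCircuit Indep D → ℓ ≤ ∣ D ∣) →
    (C C' : Subset n) → IsCircuit Indep C → IsCircuit Indep C' → C' ≢ C →
    100 * ∣ C ∣ ≤ 101 * ℓ →
    ∣ C' ∣ ≤ 4 * ∣ C' ─ C ∣
mainTheorem13 n Indep (d , v , rep) ℓ _ ℓ≤circuit C C' circC circC' C'≢C 100∣C∣≤101ℓ = begin
  ∣ C' ∣       ≡⟨ ∣p∣≡∣p─q∣+∣p∩q∣ C' C ⟩
  a + i        ≤⟨ +-monoʳ-≤ a (overlap-bound {ℓ} {a} {b} {i} ℓ≤a+i ℓ≤a+b 100[b+i]≤101ℓ) ⟩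
  4 * a        ∎
  where
  open ≤-Reasoning
  open Circuits rep
  a = ∣ C' ─ C ∣
  b = ∣ C ─ C' ∣
  i = ∣ C' ∩ C ∣
  ℓ≤a+i : ℓ ≤ a + i
  ℓ≤a+i = subst (ℓ ≤_) (∣p∣≡∣p─q∣+∣p∩q∣ C' C) (ℓ≤circuit C' circC')
  ℓ≤a+b : ℓ ≤ a + b
  ℓ≤a+b = subst (ℓ ≤_) (∣pΔq∣≡∣p─q∣+∣q─p∣ C' C)
                (circuit-bound⇒cycle-bound ℓ≤circuit (Δ-cycle circC' circC C'≢C))
  100[b+i]≤101ℓ : 100 * (b + i) ≤ 101 * ℓ
  100[b+i]≤101ℓ = subst (λ k → 100 * k ≤ 101 * ℓ) ∣C∣≡b+i 100∣C∣≤101ℓ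
    where
    ∣C∣≡b+i : ∣ C ∣ ≡ b + i
    ∣C∣≡b+i = trans (∣p∣≡∣p─q∣+∣p∩q∣ C C') (cong (λ X → b + ∣ X ∣) (∩-comm C C'))
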